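{- Let $H$ be an $(\alpha,\beta)$-colorable hypergraph and let $q\geq \alpha+\beta+1$. Then $\Gamma_q(H)$ is connected.
   Context: For a hypergraph $H=(V,E)$: the degree of a vertex is the number of edges containing it; a $\beta$-core of $H$ is a maximal subhypergraph in which every vertex has degree at least $\beta$; for $U\subseteq V$, "$U$ has a $\beta$-core" means the subhypergraph induced by $U$ (edges contained in $U$) has a nonempty $\beta$-core. A set is independent if it contains no edge of $H$. A sequence $V_1,\dots,V_\alpha$ of (possibly empty) sets is a maximally independent sequence of length $\alpha$ if for each $j$, $V_j$ is a maximal independent set in the subhypergraph induced by $V\setminus\bigcup_{i<j}V_i$. $H$ is $(\alpha,\beta)$-colorable if there does not exist a maximally independent sequence $V_1,\dots,V_\alpha$ of length $\alpha$ such that $V\setminus\bigcup_{i\leq\alpha}V_i$ has a $\beta$-core. A proper $[q]$-coloring is a map $\sigma:V\to[q]$ with no monochromatic edge; $\Gamma_q(H)$ is the graph whose vertices are the proper $[q]$-colorings of $H$, two colorings being adjacent iff they differ on exactly one vertex. -}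

module Defs where

open import Data.Nat using (ℕ; _≥_)
open import Data.Fin using (Fin)
open import Data.Fin.Subset using (Subset; _∈_; _⊆_; _─_; Nonempty; ⊤)
open import Data.Fin.Subset.Properties using (_∈?_; _⊆?_)
open import Data.List using (List; length; filter)
open import Data.List.Membership.Propositional using () renaming (_∈_ to _∈ₗ_)
open import Data.List.Relation.Unary.Unique.Propositional using (Unique)
open import Data.Vec using (Vec; []; _∷_; lookup)
open import Data.Product using (Σ; _×_; ∃)
open import Data.Unit using () renaming (⊤ to ⊤′)
open import Relation.Nullary using (¬_)
open import Relation.Nullary.Decidable using (_×-dec_)
open import Relation.Binary.PropositionalEquality using (_≡_; _≢_)

record Hypergraph (n : ℕ) : Set where
  field
    edges  : List (Subset n)
    unique : Unique edges
open Hypergraph public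

module _ {n : ℕ} (H : Hypergraph n) where

  degreeIn : Subset n → Fin n → ℕ
  degreeIn W v = length (filter (λ e → (v ∈? e) ×-dec (e ⊆? W)) (edges H))

  MinDegreeIn : ℕ → Subset n → Set
  MinDegreeIn β W = ∀ v → v ∈ W → degreeIn W v ≥ β

  -- W is the β-core of the subhypergraph induced by U: the maximal
  -- subhypergraph of H[U] in which every vertex has degree ≥ β
  -- (it is the subhypergraph induced by W; adding edges inside W only raises degrees).
  IsCore : ℕ → Subset n → Subset n → Set
  IsCore β U W = W ⊆ U × MinDegreeIn β W
               × (∀ W′ → W′ ⊆ U → MinDegreeIn β W′ → W′ ⊆ W)

  HasCore : ℕ → Subset n → Set
  HasCore β U = ∃ λ W → IsCore β U W × Nonempty W

  Independent : Subset n → Set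
  Independent S = ∀ e → e ∈ₗ edges H → ¬ (e ⊆ S)

  MaxIndependentIn : Subset n → Subset n → Set
  MaxIndependentIn R S = S ⊆ R × Independent S
                       × (∀ T → S ⊆ T → T ⊆ R → Independent T → T ⊆ S)

  MaxIndSeqFrom : ∀ {k} → Subset n → Vec (Subset n) k → Set
  MaxIndSeqFrom R [] = ⊤′
  MaxIndSeqFrom R (S ∷ Ss) = MaxIndependentIn R S × MaxIndSeqFrom (R ─ S) Ss

  leftover : ∀ {k} → Subset n → Vec (Subset n) k → Subset n
  leftover R [] = R
  leftover R (S ∷ Ss) = leftover (R ─ S) Ss

  MaxIndSeq : ∀ {k} → Vec (Subset n) k → Set
  MaxIndSeq = MaxIndSeqFrom ⊤

  Colorable : ℕ → ℕ → Set
  Colorable α β = ¬ (Σ (Vec (Subset n) α) λ Vs → MaxIndSeq Vs × HasCore β (leftover ⊤ Vs))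

  Coloring : ℕ → Set
  Coloring q = Vec (Fin q) n

  Monochromatic : ∀ {q} → Coloring q → Subset n → Set
  Monochromatic σ e = ∀ u v → u ∈ e → v ∈ e → lookup σ u ≡ lookup σ v

  Proper : ∀ {q} → Coloring q → Set
  Proper σ = ∀ e → e ∈ₗ edges H → ¬ Monochromatic σ e

  -- adjacency in Γ_q(H): differ on exactly one vertex
  DifferOnOne : ∀ {q} → Coloring q → Coloring q → Set
  DifferOnOne σ τ = ∃ λ v → lookup σ v ≢ lookup τ v × (∀ w → w ≢ v → lookup σ w ≡ lookup τ w)

  data Walk {q : ℕ} : Coloring q → Coloring q → Set where
    here : ∀ {σ} → Proper σ → Walk σ σ
    step : ∀ {σ τ ρ} → Proper σ → DifferOnOne σ τ → Walk τ ρ → Walk σ ρ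

  GammaConnected : ℕ → Set
  GammaConnected q = ∀ (σ τ : Coloring q) → Proper σ → Proper τ → Walk σ τ

-- Induction on α, for a set R of vertices recoloured from a palette P of more
-- than α + β colours while every other vertex keeps a colour outside P.
-- For α = 0 the set R has no β-core, hence is β-degenerate: peel off a vertex v
-- of degree < β in H[R], connect on R - v, and lift the path by recolouring v
-- before each move that would conflict with it; v sees fewer than β forbidden
-- colours plus the one just used, and P has β + 1 colours.
-- For α + 1 fix a maximal independent set V of R and colours c ≠ d in P. Every
-- colouring is connected to one in which exactly V has colour c: paint c on a
-- maximal independent W containing all c-coloured vertices, recolour R ─ W to
-- avoid d (the induction hypothesis for R ─ W and P - c, towards a colouring
-- that exists by the same recursion), repaint W with d and then V with c.
-- Two such colourings differ only on R ─ V, where the induction hypothesis with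
-- the palette P - c connects them.

module Submission where

open import Defs
open import Data.Nat using (ℕ; zero; suc; _+_; _≤_; _<_; _≥_; _≤?_; s≤s; z≤n)
open import Data.Nat.Properties using (≤-refl; ≤-trans; ≤-pred; n≤1+n; <-≤-trans; <-irrefl; ≰⇒>)
open import Data.Fin using (Fin) renaming (zero to fzero; suc to fsuc)
open import Data.Fin.Properties using (any?; all?) renaming (_≟_ to _≟ᶠ_)
open import Data.Fin.Subset using (Subset; Side; _∈_; _∉_; _⊆_; _─_; _-_; _∪_; ⁅_⁆; ∣_∣; Nonempty; ⊤; ⊥; inside; outside)
open import Data.Fin.Subset.Properties
  using (_∈?_; _⊆?_; anySubset?; nonempty?; x∈⁅x⁆; x∈⁅y⁆⇒x≡y; x∉⁅y⁆⇒x≢y; x∈p∪q⁻; p⊆p∪q; q⊆p∪q; p─q⊆p;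
         x∈p∧x∉q⇒x∈p─q; x∈p∧x≢y⇒x∈p-y; x∈p⇒∣p-x∣<∣p∣; p⊆q⇒∣p∣≤∣q∣; ∣p∣≤∣x∷p∣; ∉⊥; ∈⊤; ∣⊤∣≡n; ∣⊥∣≡0)
open import Data.List using (List; []; _∷_; length; filter; map; allFin)
open import Data.List.Properties using (length-map)
open import Data.List.Membership.Propositional using () renaming (_∈_ to _∈ₗ_; _∉_ to _∉ₗ_)
open import Data.List.Membership.Propositional.Properties using (∈-map⁺; ∈-filter⁺; ∈-allFin; ∉[])
open import Data.List.Relation.Unary.Any using () renaming (here to hereₗ; there to thereₗ; any? to anyₗ?)
import Data.List.Relation.Unary.All as All
open import Data.List.Relation.Binary.Sublist.Propositional using (⊆-refl)
open import Data.List.Relation.Binary.Sublist.Propositional.Properties using (filter⁺)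
open import Data.List.Relation.Binary.Sublist.Heterogeneous.Properties using (length-mono-≤)
open import Data.Vec using (Vec; []; _∷_; here; there; zipWith; lookup; _[_]≔_; tabulate)
open import Data.Vec.Properties
  using ([]=⇒lookup; lookup⇒[]=; zipWith-replicate₂; map-cong; map-id; lookup∘update; lookup∘update′; lookup∘tabulate)
import Relation.Binary.Construct.Closure.ReflexiveTransitive as Star
open import Relation.Binary.Construct.Closure.ReflexiveTransitive using (Star; ε; _◅_; _◅◅_)
open import Induction.WellFounded using (Acc; acc)
open import Data.Nat.Induction using (<-wellFounded)
open import Data.Product using (Σ; _×_; ∃; _,_; proj₁; proj₂)
open import Data.Sum using (_⊎_; inj₁; inj₂; [_,_]′)
import Data.Sum as Sum
open import Data.Empty using (⊥-elim)
open import Data.Unit using (tt)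
open import Data.Bool using (if_then_else_)
open import Relation.Nullary using (¬_; Dec; yes; no; does; contradiction)
open import Relation.Nullary.Decidable using (dec-true; _×-dec_; ¬?; _→-dec_; map′)
open import Relation.Binary.PropositionalEquality using (_≡_; _≢_; refl; sym; trans; cong; cong₂; subst)

x∈p─q⇒x∉q : ∀ {m} (p q : Subset m) {x} → x ∈ p ─ q → x ∉ q
x∈p─q⇒x∉q (_ ∷ p) (inside  ∷ q) (there x∈) (there x∈q) = x∈p─q⇒x∉q p q x∈ x∈q
x∈p─q⇒x∉q (_ ∷ p) (outside ∷ q) (there x∈) (there x∈q) = x∈p─q⇒x∉q p q x∈ x∈q

x∈p-y⇒x∈p : ∀ {m} {p : Subset m} {x y} → x ∈ p - y → x ∈ p
x∈p-y⇒x∈p {p = p} {y = y} = p─q⊆p p ⁅ y ⁆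

x∈p-y⇒x≢y : ∀ {m} {p : Subset m} {x y} → x ∈ p - y → x ≢ y
x∈p-y⇒x≢y {p = p} {y = y} x∈ = x∉⁅y⁆⇒x≢y (x∈p─q⇒x∉q p ⁅ y ⁆ x∈)

∣x∷p∣≤1+∣p∣ : ∀ {m} s (p : Subset m) → ∣ s ∷ p ∣ ≤ suc ∣ p ∣
∣x∷p∣≤1+∣p∣ inside  p = ≤-refl
∣x∷p∣≤1+∣p∣ outside p = n≤1+n _

-- `_─_` is a `zipWith` of a local function whose hidden parameters change
-- under recursion, so the count is done for an arbitrary pointwise operation.
∣p∣≤1+∣zipWith-p⁅x⁆∣ : ∀ {m} {f : Side → Side → Side} → (∀ s → f s outside ≡ s) →
                       ∀ (p : Subset m) x → ∣ p ∣ ≤ suc ∣ zipWith f p ⁅ x ⁆ ∣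
∣p∣≤1+∣zipWith-p⁅x⁆∣ {f = f} f-outside (s ∷ p) fzero =
  ≤-trans (∣x∷p∣≤1+∣p∣ s p)
          (s≤s (subst (λ r → ∣ p ∣ ≤ ∣ f s inside ∷ r ∣) (sym p⊥≡p) (∣p∣≤∣x∷p∣ (f s inside) p)))
  where
  p⊥≡p : zipWith f p ⊥ ≡ p
  p⊥≡p = trans (zipWith-replicate₂ f p outside) (trans (map-cong f-outside p) (map-id p))
∣p∣≤1+∣zipWith-p⁅x⁆∣ f-outside (inside  ∷ p) (fsuc x) rewrite f-outside inside =
  s≤s (∣p∣≤1+∣zipWith-p⁅x⁆∣ f-outside p x)
∣p∣≤1+∣zipWith-p⁅x⁆∣ f-outside (outside ∷ p) (fsuc x) rewrite f-outside outside =
  ∣p∣≤1+∣zipWith-p⁅x⁆∣ f-outside p x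

∣p∣≤1+∣p-x∣ : ∀ {m} (p : Subset m) x → ∣ p ∣ ≤ suc ∣ p - x ∣
∣p∣≤1+∣p-x∣ p x = ∣p∣≤1+∣zipWith-p⁅x⁆∣ (λ _ → refl) p x

k<∣p∣⇒k≤∣p-x∣ : ∀ {m k} (p : Subset m) x → k < ∣ p ∣ → k ≤ ∣ p - x ∣
k<∣p∣⇒k≤∣p-x∣ p x k<∣p∣ = ≤-pred (≤-trans k<∣p∣ (∣p∣≤1+∣p-x∣ p x))

⊆⇒∣p∣≤length : ∀ {m} (p : Subset m) (xs : List (Fin m)) → (∀ {x} → x ∈ p → x ∈ₗ xs) → ∣ p ∣ ≤ length xs
⊆⇒∣p∣≤length {m} p [] p⊆[] =
  subst (∣ p ∣ ≤_) (∣⊥∣≡0 m) (p⊆q⇒∣p∣≤∣q∣ {q = ⊥} (λ x∈p → ⊥-elim (∉[] (p⊆[] x∈p))))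
⊆⇒∣p∣≤length p (x ∷ xs) p⊆x∷xs = ≤-trans (∣p∣≤1+∣p-x∣ p x) (s≤s (⊆⇒∣p∣≤length (p - x) xs p-x⊆xs))
  where
  p-x⊆xs : ∀ {y} → y ∈ p - x → y ∈ₗ xs
  p-x⊆xs y∈ with p⊆x∷xs (x∈p-y⇒x∈p y∈)
  ... | hereₗ y≡x = contradiction y≡x (x∈p-y⇒x≢y y∈)
  ... | thereₗ y∈xs = y∈xs

length<∣p∣⇒∃∉ : ∀ {m} (p : Subset m) (xs : List (Fin m)) → length xs < ∣ p ∣ → ∃ λ x → x ∈ p × x ∉ₗ xs
length<∣p∣⇒∃∉ p xs xs<p with any? (λ x → (x ∈? p) ×-dec ¬? (anyₗ? (x ≟ᶠ_) xs))
... | yes found = found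
... | no none = contradiction (<-≤-trans xs<p (⊆⇒∣p∣≤length p xs covered)) (<-irrefl refl)
  where
  covered : ∀ {x} → x ∈ p → x ∈ₗ xs
  covered {x} x∈p with anyₗ? (x ≟ᶠ_) xs
  ... | yes x∈xs = x∈xs
  ... | no x∉xs = contradiction (x , x∈p , x∉xs) none

x∈p∪⁅x⁆ : ∀ {m} (p : Subset m) x → x ∈ p ∪ ⁅ x ⁆
x∈p∪⁅x⁆ p x = q⊆p∪q p ⁅ x ⁆ (x∈⁅x⁆ x)

x∈p∪⁅y⁆⁻ : ∀ {m} (p : Subset m) {x} y → x ∈ p ∪ ⁅ y ⁆ → x ∈ p ⊎ x ≡ y
x∈p∪⁅y⁆⁻ p y x∈ = Sum.map₂ (x∈⁅y⁆⇒x≡y y) (x∈p∪q⁻ p ⁅ y ⁆ x∈)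

x∉p∪⁅y⁆ : ∀ {m} {p : Subset m} {x y} → x ∉ p → x ≢ y → x ∉ p ∪ ⁅ y ⁆
x∉p∪⁅y⁆ {p = p} {y = y} x∉p x≢y x∈ = [ x∉p , x≢y ]′ (x∈p∪⁅y⁆⁻ p y x∈)

p∪⁅x⁆⊆q : ∀ {m} {p q : Subset m} {x} → p ⊆ q → x ∈ q → p ∪ ⁅ x ⁆ ⊆ q
p∪⁅x⁆⊆q {p = p} {x = x} p⊆q x∈q y∈ with x∈p∪⁅y⁆⁻ p x y∈
... | inj₁ y∈p = p⊆q y∈p
... | inj₂ refl = x∈q

⊆⊎∃∉ : ∀ {m} (p q : Subset m) → p ⊆ q ⊎ ∃ λ x → x ∈ p × x ∉ q
⊆⊎∃∉ p q with any? (λ x → (x ∈? p) ×-dec ¬? (x ∈? q))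
... | yes outlier = inj₂ outlier
... | no ¬outlier = inj₁ p⊆q
  where
  p⊆q : p ⊆ q
  p⊆q {x} x∈p with x ∈? q
  ... | yes x∈q = x∈q
  ... | no x∉q = contradiction (x , x∈p , x∉q) ¬outlier

k<∣p∣⇒nonempty : ∀ {m k} (p : Subset m) → k < ∣ p ∣ → Nonempty p
k<∣p∣⇒nonempty p size with length<∣p∣⇒∃∉ p [] (≤-trans (s≤s z≤n) size)
... | x , x∈p , _ = x , x∈p

select : ∀ {m} {P : Fin m → Set} → (∀ x → Dec (P x)) → Subset m
select P? = tabulate (λ x → does (P? x))

module _ {m} {P : Fin m → Set} (P? : ∀ x → Dec (P x)) where

  ∈-select⁺ : ∀ {x} → P x → x ∈ select P?
  ∈-select⁺ {x} px = lookup⇒[]= x _ (trans (lookup∘tabulate _ x) (dec-true (P? x) px))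

  ∈-select⁻ : ∀ {x} → x ∈ select P? → P x
  ∈-select⁻ {x} x∈ with P? x | trans (sym (lookup∘tabulate (λ y → does (P? y)) x)) ([]=⇒lookup x∈)
  ... | yes px | _ = px
  ... | no _   | ()

lookup-ext : ∀ {m} {A : Set} (xs ys : Vec A m) → (∀ i → lookup xs i ≡ lookup ys i) → xs ≡ ys
lookup-ext []       []       _  = refl
lookup-ext (x ∷ xs) (y ∷ ys) eq = cong₂ _∷_ (eq fzero) (lookup-ext xs ys (λ i → eq (fsuc i)))

module Independence {n} (H : Hypergraph n) where

  independent? : ∀ S → Dec (Independent H S)
  independent? S = map′ (λ all e e∈H → All.lookup all e∈H) (λ ind → All.tabulate (λ {e} → ind e))
                        (All.all? (λ e → ¬? (e ⊆? S)) (edges H))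

  independent-⊆ : ∀ {A B} → A ⊆ B → Independent H B → Independent H A
  independent-⊆ A⊆B indB e e∈H e⊆A = indB e e∈H (λ x∈e → A⊆B (e⊆A x∈e))

  module Greedy (R : Subset n) where

    Addable : Subset n → Fin n → Set
    Addable A x = x ∈ R × Independent H (A ∪ ⁅ x ⁆)

    addable? : ∀ A x → Dec (Addable A x)
    addable? A x = (x ∈? R) ×-dec independent? (A ∪ ⁅ x ⁆)

    greedy : List (Fin n) → Subset n → Subset n
    greedy []       A = A
    greedy (x ∷ xs) A with addable? A x
    ... | yes _ = greedy xs (A ∪ ⁅ x ⁆)
    ... | no  _ = greedy xs A

    ⊆-greedy : ∀ xs A → A ⊆ greedy xs A
    ⊆-greedy []       A = λ x∈A → x∈A
    ⊆-greedy (x ∷ xs) A with addable? A x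
    ... | yes _ = λ y∈A → ⊆-greedy xs (A ∪ ⁅ x ⁆) (p⊆p∪q ⁅ x ⁆ y∈A)
    ... | no  _ = ⊆-greedy xs A

    greedy-⊆ : ∀ xs A → A ⊆ R → greedy xs A ⊆ R
    greedy-⊆ []       A A⊆R = A⊆R
    greedy-⊆ (x ∷ xs) A A⊆R with addable? A x
    ... | yes (x∈R , _) = greedy-⊆ xs (A ∪ ⁅ x ⁆) (p∪⁅x⁆⊆q A⊆R x∈R)
    ... | no  _ = greedy-⊆ xs A A⊆R

    greedy-independent : ∀ xs A → Independent H A → Independent H (greedy xs A)
    greedy-independent []       A indA = indA
    greedy-independent (x ∷ xs) A indA with addable? A x
    ... | yes (_ , indA∪x) = greedy-independent xs (A ∪ ⁅ x ⁆) indA∪x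
    ... | no  _            = greedy-independent xs A indA

    greedy-saturated : ∀ xs A {t} → t ∈ₗ xs → Addable (greedy xs A) t → t ∈ greedy xs A
    greedy-saturated (x ∷ xs) A (hereₗ refl) (t∈R , ind) with addable? A x
    ... | yes _   = ⊆-greedy xs (A ∪ ⁅ x ⁆) (x∈p∪⁅x⁆ A x)
    ... | no  ¬ok = contradiction (t∈R , independent-⊆ A∪x⊆ ind) ¬ok
      where
      A∪x⊆ : A ∪ ⁅ x ⁆ ⊆ greedy xs A ∪ ⁅ x ⁆
      A∪x⊆ = p∪⁅x⁆⊆q (λ y∈A → p⊆p∪q ⁅ x ⁆ (⊆-greedy xs A y∈A)) (x∈p∪⁅x⁆ _ x)
    greedy-saturated (x ∷ xs) A (thereₗ t∈xs) addable with addable? A x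
    ... | yes _ = greedy-saturated xs (A ∪ ⁅ x ⁆) t∈xs addable
    ... | no  _ = greedy-saturated xs A t∈xs addable

  maxIndependent-extension : ∀ R A → A ⊆ R → Independent H A →
                             ∃ λ W → MaxIndependentIn H R W × A ⊆ W
  maxIndependent-extension R A A⊆R indA =
    W , (greedy-⊆ vs A A⊆R , greedy-independent vs A indA , maximal) , ⊆-greedy vs A
    where
    open Greedy R
    vs = allFin n
    W = greedy vs A
    maximal : ∀ T → W ⊆ T → T ⊆ R → Independent H T → T ⊆ W
    maximal T W⊆T T⊆R indT {t} t∈T =
      greedy-saturated vs A (∈-allFin t) (T⊆R t∈T , independent-⊆ (p∪⁅x⁆⊆q W⊆T t∈T) indT)

module Cores {n} (H : Hypergraph n) (β : ℕ) where

  degreeIn-mono : ∀ {W W′} v → W ⊆ W′ → degreeIn H W v ≤ degreeIn H W′ v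
  degreeIn-mono {W} {W′} v W⊆W′ = length-mono-≤ (filter⁺ (incident? W) (incident? W′) weaken (⊆-refl {x = edges H}))
    where
    incident? : ∀ X e → Dec (v ∈ e × e ⊆ X)
    incident? X e = (v ∈? e) ×-dec (e ⊆? X)
    weaken : ∀ {e e′} → e ≡ e′ → v ∈ e × e ⊆ W → v ∈ e′ × e′ ⊆ W′
    weaken refl (v∈e , e⊆W) = v∈e , λ x∈e → W⊆W′ (e⊆W x∈e)

  minDegreeIn? : ∀ W → Dec (MinDegreeIn H β W)
  minDegreeIn? W = all? (λ v → (v ∈? W) →-dec (β ≤? degreeIn H W v))

  hasCore : ∀ {R U} → U ⊆ R → Nonempty U → MinDegreeIn H β U → HasCore H β R
  hasCore {R} {U} U⊆R (u , u∈U) δU≥β = K , (K⊆R , δK≥β , ⊆K) , u , ⊆K U U⊆R δU≥β u∈U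
    where
    InDenseSubset : Fin n → Set
    InDenseSubset v = ∃ λ W → W ⊆ R × MinDegreeIn H β W × v ∈ W
    inDenseSubset? : ∀ v → Dec (InDenseSubset v)
    inDenseSubset? v = anySubset? (λ W → (W ⊆? R) ×-dec minDegreeIn? W ×-dec (v ∈? W))
    K : Subset n
    K = select inDenseSubset?
    K⊆R : K ⊆ R
    K⊆R v∈K with ∈-select⁻ inDenseSubset? v∈K
    ... | W , W⊆R , _ , v∈W = W⊆R v∈W
    ⊆K : ∀ W → W ⊆ R → MinDegreeIn H β W → W ⊆ K
    ⊆K W W⊆R δW≥β v∈W = ∈-select⁺ inDenseSubset? (W , W⊆R , δW≥β , v∈W)
    δK≥β : MinDegreeIn H β K
    δK≥β v v∈K with ∈-select⁻ inDenseSubset? v∈K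
    ... | W , W⊆R , δW≥β , v∈W = ≤-trans (δW≥β v v∈W) (degreeIn-mono v (⊆K W W⊆R δW≥β))

  Degenerate : Subset n → Set
  Degenerate R = ∀ U → U ⊆ R → Nonempty U → ∃ λ v → v ∈ U × degreeIn H U v < β

  Degenerate-⊆ : ∀ {R R′} → R′ ⊆ R → Degenerate R → Degenerate R′
  Degenerate-⊆ R′⊆R degR U U⊆R′ = degR U (λ x∈U → R′⊆R (U⊆R′ x∈U))

  coreless⇒degenerate : ∀ {R} → ¬ HasCore H β R → Degenerate R
  coreless⇒degenerate {R} noCore U U⊆R U≢∅ with any? (λ v → (v ∈? U) ×-dec (suc (degreeIn H U v) ≤? β))
  ... | yes low = low
  ... | no ¬low = contradiction (hasCore U⊆R U≢∅ δU≥β) noCore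
    where
    δU≥β : MinDegreeIn H β U
    δU≥β v v∈U with β ≤? degreeIn H U v
    ... | yes β≤δ = β≤δ
    ... | no β≰δ = contradiction (v , v∈U , ≰⇒> β≰δ) ¬low

module Recolouring {n} (H : Hypergraph n) (q : ℕ) where

  open Independence H

  Colouring : Set
  Colouring = Coloring H q

  Palette : Set
  Palette = Subset q

  AgreeOutside : Subset n → Colouring → Colouring → Set
  AgreeOutside X σ τ = ∀ u → u ∉ X → lookup σ u ≡ lookup τ u

  AgreeExcept : Fin n → Colouring → Colouring → Set
  AgreeExcept v σ τ = ∀ u → u ≢ v → lookup σ u ≡ lookup τ u

  update-agreeExcept : ∀ σ v k → AgreeExcept v (σ [ v ]≔ k) σ
  update-agreeExcept σ v k u u≢v = lookup∘update′ u≢v σ k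

  Move : (Colouring → Set) → Colouring → Colouring → Set
  Move Ok σ τ = Ok σ × Ok τ × DifferOnOne H σ τ

  Path : (Colouring → Set) → Colouring → Colouring → Set
  Path Ok = Star (Move Ok)

  module _ {Ok : Colouring → Set} where

    path-reverse : ∀ {σ τ} → Path Ok σ τ → Path Ok τ σ
    path-reverse = Star.reverse λ (okσ , okτ , v , σv≢τv , agree) →
      okτ , okσ , v , (λ eq → σv≢τv (sym eq)) , (λ u u≢v → sym (agree u u≢v))

    path-agreeExcept : ∀ {σ τ} v → Ok σ → Ok τ → AgreeExcept v σ τ → Path Ok σ τ
    path-agreeExcept {σ} {τ} v okσ okτ agree with lookup σ v ≟ᶠ lookup τ v
    ... | no σv≢τv = (okσ , okτ , v , σv≢τv , agree) ◅ ε
    ... | yes σv≡τv = subst (Path Ok σ) (lookup-ext σ τ agreeEverywhere) ε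
      where
      agreeEverywhere : ∀ u → lookup σ u ≡ lookup τ u
      agreeEverywhere u with u ≟ᶠ v
      ... | yes refl = σv≡τv
      ... | no u≢v = agree u u≢v

  path-weaken : ∀ {Ok Ok′ : Colouring → Set} → (∀ {σ} → Ok σ → Ok′ σ) → ∀ {σ τ} → Path Ok σ τ → Path Ok′ σ τ
  path-weaken f = Star.map λ (okσ , okτ , differ) → f okσ , f okτ , differ

  Avoids : Subset n → Subset n → Set
  Avoids e I = ∀ {u} → u ∈ e → u ∉ I

  -- I collects the vertices peeled off by the degeneracy recursion; their edges
  -- are checked again when the vertex is put back.
  ProperOff : Subset n → Colouring → Set
  ProperOff I σ = ∀ e → e ∈ₗ edges H → Avoids e I → ¬ Monochromatic H σ e

  ProperOutside : Subset n → Subset n → Colouring → Set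
  ProperOutside R I σ = ∀ e → e ∈ₗ edges H → Avoids e I → Avoids e R → ¬ Monochromatic H σ e

  proper⇒properOff : ∀ {σ} → Proper H σ → ProperOff ⊥ σ
  proper⇒properOff proper e e∈H _ = proper e e∈H

  properOff⊥⇒proper : ∀ {σ} → ProperOff ⊥ σ → Proper H σ
  properOff⊥⇒proper proper e e∈H = proper e e∈H (λ _ → ∉⊥)

  monochromatic-transport : ∀ {v σ τ e} → AgreeExcept v σ τ → v ∉ e → Monochromatic H σ e → Monochromatic H τ e
  monochromatic-transport {v} agree v∉e mono x y x∈e y∈e =
    trans (sym (agree x (≢v x∈e))) (trans (mono x y x∈e y∈e) (agree y (≢v y∈e)))
    where
    ≢v : ∀ {x} → x ∈ _ → x ≢ v
    ≢v x∈e refl = v∉e x∈e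

  avoids-∪⁻ˡ : ∀ {e I J} → Avoids e (I ∪ J) → Avoids e I
  avoids-∪⁻ˡ {J = J} avoids u∈e u∈I = avoids u∈e (p⊆p∪q J u∈I)

  properOff-forget : ∀ {I v σ τ} → ProperOff I τ → AgreeExcept v σ τ → ProperOff (I ∪ ⁅ v ⁆) σ
  properOff-forget {I} {v} {σ} {τ} properτ agree e e∈H avoids mono =
    properτ e e∈H (avoids-∪⁻ˡ avoids)
      (monochromatic-transport {σ = σ} {τ = τ} agree (λ v∈e → avoids v∈e (x∈p∪⁅x⁆ I v)) mono)

  ⊥-independent : ∀ {σ : Colouring} → (∀ e → e ∈ₗ edges H → e ⊆ ⊥ → ¬ Monochromatic H σ e) → Independent H ⊥
  ⊥-independent proper e e∈H e⊆⊥ = proper e e∈H e⊆⊥ λ x _ x∈e _ → ⊥-elim (∉⊥ (e⊆⊥ x∈e))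

  ⊆⊥⇒avoids : ∀ {e X} → e ⊆ ⊥ → Avoids e X
  ⊆⊥⇒avoids e⊆⊥ x∈e _ = ∉⊥ (e⊆⊥ x∈e)

  NontrivialOff : Subset n → Set
  NontrivialOff I = ∀ e → e ∈ₗ edges H → Avoids e I → ∀ v → ∃ λ u → u ∈ e × u ≢ v

  properOff⇒nontrivialOff : ∀ {I σ} → ProperOff I σ → NontrivialOff I
  properOff⇒nontrivialOff {σ = σ} proper e e∈H avoids v
    with any? (λ u → (u ∈? e) ×-dec ¬? (u ≟ᶠ v))
  ... | yes other = other
  ... | no ¬other = contradiction mono (proper e e∈H avoids)
    where
    ≡v : ∀ {u} → u ∈ e → u ≡ v
    ≡v {u} u∈e with u ≟ᶠ v
    ... | yes u≡v = u≡v
    ... | no u≢v = contradiction (u , u∈e , u≢v) ¬other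
    mono : Monochromatic H σ e
    mono x y x∈e y∈e = cong (lookup σ) (trans (≡v x∈e) (sym (≡v y∈e)))

  AvoidsPaletteOutside : Palette → Subset n → Subset n → Colouring → Set
  AvoidsPaletteOutside P R I σ = ∀ {u} → u ∉ R → u ∉ I → lookup σ u ∉ P

  record Confined (P : Palette) (R I : Subset n) (σ : Colouring) : Set where
    constructor mkConfined
    field
      ∈R⇒∈P : ∀ {u} → u ∈ R → lookup σ u ∈ P
      ∉R⇒∉P : AvoidsPaletteOutside P R I σ

  record Admissible (P : Palette) (R I : Subset n) (σ : Colouring) : Set where
    constructor mkAdmissible
    field
      proper   : ProperOff I σ
      confined : Confined P R I σ

  confined-remove : ∀ {P R I v σ τ} → AgreeExcept v σ τ → Confined P R I τ → Confined P (R - v) (I ∪ ⁅ v ⁆) σ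
  confined-remove {P} {R} {I} {v} {σ} agree (mkConfined ∈R⇒∈P ∉R⇒∉P) = mkConfined ∈R-v⇒∈P ∉R-v⇒∉P
    where
    ∈R-v⇒∈P : ∀ {u} → u ∈ R - v → lookup σ u ∈ P
    ∈R-v⇒∈P {u} u∈ = subst (_∈ P) (sym (agree u (x∈p-y⇒x≢y u∈))) (∈R⇒∈P (x∈p-y⇒x∈p u∈))
    ∉R-v⇒∉P : AvoidsPaletteOutside P (R - v) (I ∪ ⁅ v ⁆) σ
    ∉R-v⇒∉P {u} u∉R-v u∉I∪v σu∈P =
      ∉R⇒∉P (λ u∈R → u∉R-v (x∈p∧x≢y⇒x∈p-y u∈R u≢v)) (λ u∈I → u∉I∪v (p⊆p∪q ⁅ v ⁆ u∈I))
            (subst (_∈ P) (agree u u≢v) σu∈P)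
      where
      u≢v : u ≢ v
      u≢v refl = u∉I∪v (x∈p∪⁅x⁆ I v)

  confined-insert : ∀ {P R I v σ τ} → v ∈ R → AgreeExcept v σ τ → lookup σ v ∈ P →
                    Confined P (R - v) (I ∪ ⁅ v ⁆) τ → Confined P R I σ
  confined-insert {P} {R} {I} {v} {σ} v∈R agree σv∈P (mkConfined ∈R-v⇒∈P ∉R-v⇒∉P) = mkConfined ∈R⇒∈P ∉R⇒∉P
    where
    ∈R⇒∈P : ∀ {u} → u ∈ R → lookup σ u ∈ P
    ∈R⇒∈P {u} u∈R with u ≟ᶠ v
    ... | yes refl = σv∈P
    ... | no u≢v = subst (_∈ P) (sym (agree u u≢v)) (∈R-v⇒∈P (x∈p∧x≢y⇒x∈p-y u∈R u≢v))
    ∉R⇒∉P : AvoidsPaletteOutside P R I σ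
    ∉R⇒∉P {u} u∉R u∉I σu∈P =
      ∉R-v⇒∉P (λ u∈R-v → u∉R (x∈p-y⇒x∈p u∈R-v)) (x∉p∪⁅y⁆ u∉I u≢v) (subst (_∈ P) (agree u u≢v) σu∈P)
      where
      u≢v : u ≢ v
      u≢v refl = u∉R v∈R

  -- Junk value `lookup π v` when e has no vertex other than v.
  otherColour : Colouring → Fin n → Subset n → Fin q
  otherColour π v e with any? (λ u → (u ∈? e) ×-dec ¬? (u ≟ᶠ v))
  ... | yes (u , _) = lookup π u
  ... | no _ = lookup π v

  otherColour-witness : ∀ π v e → (∃ λ u → u ∈ e × u ≢ v) →
                        ∃ λ u → u ∈ e × u ≢ v × lookup π u ≡ otherColour π v e
  otherColour-witness π v e other with any? (λ u → (u ∈? e) ×-dec ¬? (u ≟ᶠ v))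
  ... | yes (u , u∈e , u≢v) = u , u∈e , u≢v , refl
  ... | no ¬other = contradiction other ¬other

  -- One colour per edge of H[R] through v; any colour outside the list is
  -- free at v as far as the edges inside R are concerned.
  forbidden : Colouring → Fin n → Subset n → List (Fin q)
  forbidden π v R = map (otherColour π v) (filter (λ e → (v ∈? e) ×-dec (e ⊆? R)) (edges H))

  length-forbidden : ∀ π v R → length (forbidden π v R) ≡ degreeIn H R v
  length-forbidden π v R = length-map (otherColour π v) (filter (λ e → (v ∈? e) ×-dec (e ⊆? R)) (edges H))

  otherColour∈forbidden : ∀ {π v R e} → e ∈ₗ edges H → v ∈ e → e ⊆ R → otherColour π v e ∈ₗ forbidden π v R
  otherColour∈forbidden {π} {v} {R} e∈H v∈e e⊆R =
    ∈-map⁺ (otherColour π v) (∈-filter⁺ (λ e → (v ∈? e) ×-dec (e ⊆? R)) e∈H (v∈e , e⊆R))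

  properOff-recolour : ∀ {P R I v} {χ ρ π : Colouring} → NontrivialOff I → v ∈ R →
    ProperOff (I ∪ ⁅ v ⁆) ρ → AgreeExcept v χ ρ → Confined P R I χ →
    lookup χ v ∉ₗ forbidden π v R →
    (∀ u → u ≢ v → lookup χ u ≡ lookup π u ⊎ lookup χ u ≢ lookup χ v) →
    ProperOff I χ
  properOff-recolour {P} {R} {I} {v} {χ} {ρ} {π} nontrivial v∈R properρ agree conf fresh unchanged e e∈H avoids mono
    with v ∈? e
  ... | no v∉e = properρ e e∈H avoids′ (monochromatic-transport {σ = χ} {τ = ρ} agree v∉e mono)
    where
    avoids′ : Avoids e (I ∪ ⁅ v ⁆)
    avoids′ u∈e u∈I∪v with x∈p∪⁅y⁆⁻ I v u∈I∪v
    ... | inj₁ u∈I = avoids u∈e u∈I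
    ... | inj₂ refl = v∉e u∈e
  ... | yes v∈e with ⊆⊎∃∉ e R
  ...   | inj₂ (x , x∈e , x∉R) =
          Confined.∉R⇒∉P conf x∉R (avoids x∈e) (subst (_∈ P) (sym (mono x v x∈e v∈e)) (Confined.∈R⇒∈P conf v∈R))
  ...   | inj₁ e⊆R with otherColour-witness π v e (nontrivial e e∈H avoids v)
  ...     | u , u∈e , u≢v , πu≡other with unchanged u u≢v
  ...       | inj₁ χu≡πu = fresh (subst (_∈ₗ forbidden π v R)
                                          (trans (sym πu≡other) (trans (sym χu≡πu) (mono u v u∈e v∈e)))
                                          (otherColour∈forbidden e∈H v∈e e⊆R))
  ...       | inj₂ χu≢χv = χu≢χv (mono u v u∈e v∈e)

  opaque
    paint : Subset n → Fin q → Colouring → Colouring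
    paint W k σ = tabulate (λ u → if does (u ∈? W) then k else lookup σ u)

    paint-∈ : ∀ {W k σ u} → u ∈ W → lookup (paint W k σ) u ≡ k
    paint-∈ {W} {k} {σ} {u} u∈W rewrite lookup∘tabulate (λ u → if does (u ∈? W) then k else lookup σ u) u
      with u ∈? W
    ... | yes _ = refl
    ... | no u∉W = contradiction u∈W u∉W

    paint-∉ : ∀ {W k σ u} → u ∉ W → lookup (paint W k σ) u ≡ lookup σ u
    paint-∉ {W} {k} {σ} {u} u∉W rewrite lookup∘tabulate (λ u → if does (u ∈? W) then k else lookup σ u) u
      with u ∈? W
    ... | yes u∈W = contradiction u∈W u∉W
    ... | no _ = refl

  -- W′ ⊆ W covers the intermediate stages of painting W one vertex at a time.
  paint-properOff : ∀ {I W W′ k σ} → ProperOff I σ → W′ ⊆ W → Independent H W →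
                    (∀ u → lookup σ u ≡ k → u ∈ W) → ProperOff I (paint W′ k σ)
  paint-properOff {I} {W} {W′} {k} {σ} properσ W′⊆W indW k⊆W e e∈H avoids mono with ⊆⊎∃∉ e W
  ... | inj₁ e⊆W = indW e e∈H e⊆W
  ... | inj₂ (x , x∈e , x∉W) = properσ e e∈H avoids monoσ
    where
    x∉W′ : x ∉ W′
    x∉W′ x∈W′ = x∉W (W′⊆W x∈W′)
    unpainted : ∀ {y} → y ∈ e → lookup (paint W′ k σ) y ≡ lookup σ y
    unpainted {y} y∈e with y ∈? W′
    ... | no y∉W′ = paint-∉ y∉W′
    ... | yes y∈W′ =
      contradiction (k⊆W x (trans (sym (paint-∉ x∉W′)) (trans (mono x y x∈e y∈e) (paint-∈ y∈W′)))) x∉W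
    monoσ : Monochromatic H σ e
    monoσ a b a∈e b∈e = trans (sym (unpainted a∈e)) (trans (mono a b a∈e b∈e) (unpainted b∈e))

  paint-path : ∀ {I W k σ} → Independent H W → (∀ u → lookup σ u ≡ k → u ∈ W) → ProperOff I σ →
               Path (ProperOff I) σ (paint W k σ)
  paint-path {I} {W} {k} {σ} indW k⊆W properσ =
    subst (λ τ → Path (ProperOff I) τ (paint W k σ)) (lookup-ext _ σ (λ u → paint-∉ (∉⊥ {x = u})))
          (extend (allFin n) ⊥ (λ x∈⊥ → ⊥-elim (∉⊥ x∈⊥))
                  (λ {u} _ u∉allFin → contradiction (∈-allFin u) u∉allFin))
    where
    proper : ∀ {W′} → W′ ⊆ W → ProperOff I (paint W′ k σ)
    proper W′⊆W = paint-properOff properσ W′⊆W indW k⊆W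
    extend : ∀ xs W′ → W′ ⊆ W → (∀ {u} → u ∈ W → u ∉ₗ xs → u ∈ W′) →
             Path (ProperOff I) (paint W′ k σ) (paint W k σ)
    extend [] W′ W′⊆W rest⊆W′ = subst (Path (ProperOff I) (paint W′ k σ)) (lookup-ext _ _ same) ε
      where
      same : ∀ u → lookup (paint W′ k σ) u ≡ lookup (paint W k σ) u
      same u with u ∈? W
      ... | yes u∈W = trans (paint-∈ (rest⊆W′ u∈W λ ())) (sym (paint-∈ u∈W))
      ... | no u∉W = trans (paint-∉ (λ u∈W′ → u∉W (W′⊆W u∈W′))) (sym (paint-∉ u∉W))
    extend (x ∷ xs) W′ W′⊆W rest⊆W′ with x ∈? W
    ... | no x∉W = extend xs W′ W′⊆W λ u∈W u∉xs → rest⊆W′ u∈W λ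
            { (hereₗ refl) → x∉W u∈W ; (thereₗ u∈xs) → u∉xs u∈xs }
    ... | yes x∈W = path-agreeExcept x (proper W′⊆W) (proper W″⊆W) agree ◅◅ extend xs W″ W″⊆W rest⊆W″
      where
      W″ = W′ ∪ ⁅ x ⁆
      W″⊆W : W″ ⊆ W
      W″⊆W = p∪⁅x⁆⊆q W′⊆W x∈W
      rest⊆W″ : ∀ {u} → u ∈ W → u ∉ₗ xs → u ∈ W″
      rest⊆W″ {u} u∈W u∉xs with u ≟ᶠ x
      ... | yes refl = x∈p∪⁅x⁆ W′ x
      ... | no u≢x = p⊆p∪q ⁅ x ⁆ (rest⊆W′ u∈W λ { (hereₗ u≡x) → u≢x u≡x ; (thereₗ u∈xs) → u∉xs u∈xs })
      agree : AgreeExcept x (paint W′ k σ) (paint W″ k σ)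
      agree u u≢x with u ∈? W′
      ... | yes u∈W′ = trans (paint-∈ u∈W′) (sym (paint-∈ (p⊆p∪q ⁅ x ⁆ u∈W′)))
      ... | no u∉W′ = trans (paint-∉ u∉W′) (sym (paint-∉ (x∉p∪⁅y⁆ u∉W′ u≢x)))

  admissible-recolour : ∀ {P R I v} {χ ρ π : Colouring} → NontrivialOff I → v ∈ R →
    Admissible P (R - v) (I ∪ ⁅ v ⁆) ρ → AgreeExcept v χ ρ →
    lookup χ v ∈ P → lookup χ v ∉ₗ forbidden π v R →
    (∀ u → u ≢ v → lookup χ u ≡ lookup π u ⊎ lookup χ u ≢ lookup χ v) →
    Admissible P R I χ
  admissible-recolour {ρ = ρ} nontrivial v∈R (mkAdmissible properρ confinedρ) agree χv∈P fresh unchanged =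
    mkAdmissible (properOff-recolour {ρ = ρ} nontrivial v∈R properρ agree confined fresh unchanged) confined
    where
    confined = confined-insert {τ = ρ} v∈R agree χv∈P confinedρ

  admissible-forget : ∀ {P R I v σ τ} → Admissible P R I τ → AgreeExcept v σ τ → Admissible P (R - v) (I ∪ ⁅ v ⁆) σ
  admissible-forget {v = v} {σ} {τ} (mkAdmissible properτ confinedτ) agree =
    mkAdmissible (properOff-forget {v = v} {σ = σ} {τ = τ} properτ agree)
                 (confined-remove {v = v} {σ = σ} {τ = τ} agree confinedτ)

  paint-agreeOutside : ∀ {R W k σ} → W ⊆ R → AgreeOutside R (paint W k σ) σ
  paint-agreeOutside W⊆R u u∉R = paint-∉ λ u∈W → u∉R (W⊆R u∈W)

  paint-properOutside : ∀ {P R I W k σ} → ProperOutside R I σ → AvoidsPaletteOutside P R I σ → k ∈ P →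
                        Independent H W → ProperOutside (R ─ W) I (paint W k σ)
  paint-properOutside {P} {R} {I} {W} {k} {σ} properσ avoidsσ k∈P indW e e∈H avoidsI avoidsR─W mono
    with ⊆⊎∃∉ e W
  ... | inj₁ e⊆W = indW e e∈H e⊆W
  ... | inj₂ (x , x∈e , x∉W) = properσ e e∈H avoidsI avoidsR monoσ
    where
    ∉R : ∀ {y} → y ∈ e → y ∉ W → y ∉ R
    ∉R y∈e y∉W y∈R = avoidsR─W y∈e (x∈p∧x∉q⇒x∈p─q y∈R y∉W)
    ∉W : ∀ {y} → y ∈ e → y ∉ W
    ∉W {y} y∈e y∈W = avoidsσ (∉R x∈e x∉W) (avoidsI x∈e)
      (subst (_∈ P) (trans (sym (paint-∈ y∈W)) (trans (sym (mono x y x∈e y∈e)) (paint-∉ x∉W))) k∈P)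
    avoidsR : Avoids e R
    avoidsR y∈e = ∉R y∈e (∉W y∈e)
    monoσ : Monochromatic H σ e
    monoσ a b a∈e b∈e = trans (sym (paint-∉ (∉W a∈e))) (trans (mono a b a∈e b∈e) (paint-∉ (∉W b∈e)))

  paint-avoidsPaletteOutside : ∀ {P R I W k σ} → AvoidsPaletteOutside P R I σ →
                               AvoidsPaletteOutside (P - k) (R ─ W) I (paint W k σ)
  paint-avoidsPaletteOutside {P} {R} {I} {W} {k} {σ} avoidsσ {u} u∉R─W u∉I with u ∈? W
  ... | yes u∈W = λ paint∈ → x∈p-y⇒x≢y (subst (_∈ P - k) (paint-∈ u∈W) paint∈) refl
  ... | no u∉W = λ paint∈ → avoidsσ (λ u∈R → u∉R─W (x∈p∧x∉q⇒x∈p─q u∈R u∉W)) u∉I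
                              (subst (_∈ P) (paint-∉ u∉W) (x∈p-y⇒x∈p paint∈))

  colourClass⊆ : ∀ {P R W k σ} → Confined P R ⊥ σ → k ∈ P → (∀ {u} → u ∈ R → lookup σ u ≡ k → u ∈ W) →
                 ∀ u → lookup σ u ≡ k → u ∈ W
  colourClass⊆ {P} {R} conf k∈P k⊆W u σu≡k with u ∈? R
  ... | yes u∈R = k⊆W u∈R σu≡k
  ... | no u∉R = contradiction (subst (_∈ P) (sym σu≡k) k∈P) (Confined.∉R⇒∉P conf u∉R ∉⊥)

  paint-admissible : ∀ {P R W k σ} → Admissible P R ⊥ σ → Independent H W → k ∈ P →
                     (∀ {u} → u ∈ R → lookup σ u ≡ k → u ∈ W) → Admissible (P - k) (R ─ W) ⊥ (paint W k σ)
  paint-admissible {P} {R} {W} {k} {σ} (mkAdmissible properσ conf) indW k∈P k⊆W =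
    mkAdmissible (paint-properOff properσ (λ u∈W → u∈W) indW (colourClass⊆ conf k∈P k⊆W)) (mkConfined ∈R─W ∉R─W)
    where
    ∈R─W : ∀ {u} → u ∈ R ─ W → lookup (paint W k σ) u ∈ P - k
    ∈R─W {u} u∈R─W = subst (_∈ P - k) (sym (paint-∉ u∉W))
                       (x∈p∧x≢y⇒x∈p-y (Confined.∈R⇒∈P conf u∈R) (λ σu≡k → u∉W (k⊆W u∈R σu≡k)))
      where
      u∈R = p─q⊆p R W u∈R─W
      u∉W = x∈p─q⇒x∉q R W u∈R─W
    ∉R─W : AvoidsPaletteOutside (P - k) (R ─ W) ⊥ (paint W k σ)
    ∉R─W {u} u∉R─W _ paintu∈P-k with u ∈? W
    ... | yes u∈W = x∈p-y⇒x≢y (subst (_∈ P - k) (paint-∈ u∈W) paintu∈P-k) refl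
    ... | no u∉W = Confined.∉R⇒∉P conf (λ u∈R → u∉R─W (x∈p∧x∉q⇒x∈p─q u∈R u∉W)) ∉⊥
                     (x∈p-y⇒x∈p (subst (_∈ P - k) (paint-∉ u∉W) paintu∈P-k))

  paint-admissible⁻ : ∀ {P R W k σ} → Admissible (P - k) (R ─ W) ⊥ σ → W ⊆ R → Independent H W → k ∈ P →
                      (∀ u → u ∉ R → lookup σ u ≢ k) → Admissible P R ⊥ (paint W k σ)
  paint-admissible⁻ {P} {R} {W} {k} {σ} (mkAdmissible properσ conf) W⊆R indW k∈P σ≢k =
    mkAdmissible (paint-properOff properσ (λ u∈W → u∈W) indW k⊆W) (mkConfined ∈R ∉R)
    where
    ∈R─W⇒≢k : ∀ {u} → u ∈ R ─ W → lookup σ u ≢ k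
    ∈R─W⇒≢k u∈R─W = x∈p-y⇒x≢y (Confined.∈R⇒∈P conf u∈R─W)
    k⊆W : ∀ u → lookup σ u ≡ k → u ∈ W
    k⊆W u σu≡k with u ∈? W | u ∈? R
    ... | yes u∈W | _       = u∈W
    ... | no u∉W  | yes u∈R = contradiction σu≡k (∈R─W⇒≢k (x∈p∧x∉q⇒x∈p─q u∈R u∉W))
    ... | no _    | no u∉R  = contradiction σu≡k (σ≢k u u∉R)
    ∈R : ∀ {u} → u ∈ R → lookup (paint W k σ) u ∈ P
    ∈R {u} u∈R with u ∈? W
    ... | yes u∈W = subst (_∈ P) (sym (paint-∈ u∈W)) k∈P
    ... | no u∉W = subst (_∈ P) (sym (paint-∉ u∉W)) (x∈p-y⇒x∈p (Confined.∈R⇒∈P conf (x∈p∧x∉q⇒x∈p─q u∈R u∉W)))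
    ∉R : AvoidsPaletteOutside P R ⊥ (paint W k σ)
    ∉R {u} u∉R _ paintu∈P = Confined.∉R⇒∉P conf (λ u∈R─W → u∉R (p─q⊆p R W u∈R─W)) ∉⊥
                              (x∈p∧x≢y⇒x∈p-y σu∈P (σ≢k u u∉R))
      where
      σu∈P : lookup σ u ∈ P
      σu∈P = subst (_∈ P) (paint-∉ λ u∈W → u∉R (W⊆R u∈W)) paintu∈P

  paint-fresh-admissible : ∀ {P R W k σ} → Admissible P R ⊥ σ → Independent H W → k ∉ P →
                           (∀ u → lookup σ u ≢ k) → Admissible P (R ─ W) ⊥ (paint W k σ)
  paint-fresh-admissible {P} {R} {W} {k} {σ} (mkAdmissible properσ conf) indW k∉P σ≢k =
    mkAdmissible (paint-properOff properσ (λ u∈W → u∈W) indW (λ u σu≡k → contradiction σu≡k (σ≢k u)))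
                 (mkConfined ∈R─W ∉R─W)
    where
    ∈R─W : ∀ {u} → u ∈ R ─ W → lookup (paint W k σ) u ∈ P
    ∈R─W u∈R─W = subst (_∈ P) (sym (paint-∉ (x∈p─q⇒x∉q R W u∈R─W))) (Confined.∈R⇒∈P conf (p─q⊆p R W u∈R─W))
    ∉R─W : AvoidsPaletteOutside P (R ─ W) ⊥ (paint W k σ)
    ∉R─W {u} u∉R─W _ with u ∈? W
    ... | yes u∈W = λ paintu∈P → k∉P (subst (_∈ P) (paint-∈ u∈W) paintu∈P)
    ... | no u∉W = λ paintu∈P → Confined.∉R⇒∉P conf (λ u∈R → u∉R─W (x∈p∧x∉q⇒x∈p─q u∈R u∉W)) ∉⊥
                                   (subst (_∈ P) (paint-∉ u∉W) paintu∈P)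

  opaque
    colourClassIn : Subset n → Fin q → Colouring → Subset n
    colourClassIn R c χ = select λ u → (u ∈? R) ×-dec (lookup χ u ≟ᶠ c)

    ∈-colourClassIn⁺ : ∀ {R c χ u} → u ∈ R → lookup χ u ≡ c → u ∈ colourClassIn R c χ
    ∈-colourClassIn⁺ {R} {c} {χ} u∈R χu≡c = ∈-select⁺ (λ u → (u ∈? R) ×-dec (lookup χ u ≟ᶠ c)) (u∈R , χu≡c)

    ∈-colourClassIn⁻ : ∀ {R c χ u} → u ∈ colourClassIn R c χ → u ∈ R × lookup χ u ≡ c
    ∈-colourClassIn⁻ {R} {c} {χ} = ∈-select⁻ (λ u → (u ∈? R) ×-dec (lookup χ u ≟ᶠ c))

  colourClassIn-independent : ∀ {R c χ} → ProperOff ⊥ χ → Independent H (colourClassIn R c χ)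
  colourClassIn-independent properχ e e∈H e⊆C = properχ e e∈H (λ _ → ∉⊥) λ x y x∈e y∈e →
    trans (proj₂ (∈-colourClassIn⁻ (e⊆C x∈e))) (sym (proj₂ (∈-colourClassIn⁻ (e⊆C y∈e))))

  path⇒walk : ∀ {σ τ} → ProperOff ⊥ σ → Path (ProperOff ⊥) σ τ → Walk H σ τ
  path⇒walk {σ} properσ ε = here (properOff⊥⇒proper {σ = σ} properσ)
  path⇒walk {σ} properσ ((_ , properσ′ , differ) ◅ steps) =
    step (properOff⊥⇒proper {σ = σ} properσ) differ (path⇒walk properσ′ steps)

module Reconfiguration {n} (H : Hypergraph n) (q β : ℕ) where

  open Independence H
  open Cores H β
  open Recolouring H q

  record Extension (P : Palette) (R I : Subset n) (σ : Colouring) : Set where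
    field
      colouring  : Colouring
      admissible : Admissible P R I colouring
      agrees     : AgreeOutside R colouring σ

  -- Greedy colouring along a degeneracy order: a vertex of degree < β in H[R]
  -- sees fewer than β forbidden colours, and an edge leaving R cannot become
  -- monochromatic since the vertices outside R ∪ I avoid the palette.
  extend-degenerate : ∀ {R I P σ} → Acc _<_ ∣ R ∣ → Degenerate R → NontrivialOff I → β ≤ ∣ P ∣ →
                      ProperOutside R I σ → AvoidsPaletteOutside P R I σ → Extension P R I σ
  extend-degenerate {R} {I} {P} {σ} (acc smaller) degR nontrivial β≤∣P∣ properσ avoidsσ with nonempty? R
  ... | no R≡∅ = record
    { colouring  = σ
    ; admissible = mkAdmissible (λ e e∈H avoids → properσ e e∈H avoids λ u∈e u∈R → R≡∅ (_ , u∈R))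
                                (mkConfined (λ u∈R → ⊥-elim (R≡∅ (_ , u∈R))) avoidsσ)
    ; agrees     = λ _ _ → refl
    }
  ... | yes R≢∅ with degR R (λ u∈R → u∈R) R≢∅
  ...   | v , v∈R , δv<β = record
    { colouring  = ρ
    ; admissible = admissible-recolour {ρ = ρ′} nontrivial v∈R (Extension.admissible ext)
                     (update-agreeExcept ρ′ v j) (subst (_∈ P) (sym ρv≡j) j∈P)
                     (subst (_∉ₗ forbidden ρ′ v R) (sym ρv≡j) j∉forbidden)
                     (λ u u≢v → inj₁ (update-agreeExcept ρ′ v j u u≢v))
    ; agrees     = λ u u∉R → trans (update-agreeExcept ρ′ v j u (λ { refl → u∉R v∈R }))
                                   (Extension.agrees ext u (λ u∈R-v → u∉R (x∈p-y⇒x∈p u∈R-v)))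
    }
    where
    ext : Extension P (R - v) (I ∪ ⁅ v ⁆) σ
    ext = extend-degenerate (smaller (x∈p⇒∣p-x∣<∣p∣ v∈R)) (Degenerate-⊆ x∈p-y⇒x∈p degR)
            (λ e e∈H avoids → nontrivial e e∈H (avoids-∪⁻ˡ avoids))
            β≤∣P∣ properσ′ avoidsσ′
      where
      properσ′ : ProperOutside (R - v) (I ∪ ⁅ v ⁆) σ
      properσ′ e e∈H avoidsI∪v avoidsR-v = properσ e e∈H (avoids-∪⁻ˡ avoidsI∪v) λ u∈e u∈R →
        avoidsR-v u∈e (x∈p∧x≢y⇒x∈p-y u∈R λ { refl → avoidsI∪v u∈e (x∈p∪⁅x⁆ I v) })
      avoidsσ′ : AvoidsPaletteOutside P (R - v) (I ∪ ⁅ v ⁆) σ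
      avoidsσ′ u∉R-v u∉I∪v = avoidsσ (λ u∈R → u∉R-v (x∈p∧x≢y⇒x∈p-y u∈R λ { refl → u∉I∪v (x∈p∪⁅x⁆ I v) }))
                                      (λ u∈I → u∉I∪v (p⊆p∪q ⁅ v ⁆ u∈I))
    ρ′ = Extension.colouring ext
    fresh = length<∣p∣⇒∃∉ P (forbidden ρ′ v R)
              (subst (_< ∣ P ∣) (sym (length-forbidden ρ′ v R)) (<-≤-trans δv<β β≤∣P∣))
    j = proj₁ fresh
    j∈P = proj₁ (proj₂ fresh)
    j∉forbidden = proj₂ (proj₂ fresh)
    ρ = ρ′ [ v ]≔ j
    ρv≡j : lookup ρ v ≡ j
    ρv≡j = lookup∘update v ρ′ j

  module Lift {P : Palette} {R I : Subset n} {v : Fin n}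
              (v∈R : v ∈ R) (δv<β : degreeIn H R v < β) (β<∣P∣ : suc β ≤ ∣ P ∣) where

    -- Follow a path on R - v; before each move at a vertex w ≠ v, first give v
    -- a colour that is free at v and differs from the new colour of w.
    lift : ∀ {ρ ρ′ π τ} → Path (Admissible P (R - v) (I ∪ ⁅ v ⁆)) ρ ρ′ →
           AgreeExcept v π ρ → AgreeExcept v τ ρ′ → Admissible P R I π → Admissible P R I τ →
           Path (Admissible P R I) π τ
    lift ε π≈ρ τ≈ρ okπ okτ = path-agreeExcept v okπ okτ λ u u≢v → trans (π≈ρ u u≢v) (sym (τ≈ρ u u≢v))
    lift {ρ} {π = π} (_◅_ {j = ρ₂} (okρ , okρ₂ , w , _ , ρ≈ρ₂) steps) π≈ρ τ≈ρ′ okπ okτ with w ≟ᶠ v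
    ... | yes refl = lift steps (λ u u≢v → trans (π≈ρ u u≢v) (ρ≈ρ₂ u u≢v)) τ≈ρ′ okπ okτ
    ... | no w≢v =
      path-agreeExcept {σ = π} {τ = π₁} v okπ okπ₁ (λ u u≢v → sym (update-agreeExcept π v j u u≢v)) ◅◅
      path-agreeExcept {σ = π₁} {τ = π₂} w okπ₁ okπ₂ (λ u u≢w → sym (update-agreeExcept π₁ w k u u≢w)) ◅◅
      lift steps π₂≈ρ₂ τ≈ρ′ okπ₂ okτ
      where
      k = lookup ρ₂ w
      fresh = length<∣p∣⇒∃∉ P (k ∷ forbidden π v R)
                (subst (λ m → suc m < ∣ P ∣) (sym (length-forbidden π v R)) (<-≤-trans (s≤s δv<β) β<∣P∣))
      j = proj₁ fresh
      j∈P = proj₁ (proj₂ fresh)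
      j∉ = proj₂ (proj₂ fresh)
      π₁ = π [ v ]≔ j
      π₂ = π₁ [ w ]≔ k
      π₁v≡j : lookup π₁ v ≡ j
      π₁v≡j = lookup∘update v π j
      π₂v≡j : lookup π₂ v ≡ j
      π₂v≡j = trans (lookup∘update′ (λ v≡w → w≢v (sym v≡w)) π₁ k) π₁v≡j
      nontrivial : NontrivialOff I
      nontrivial = properOff⇒nontrivialOff {σ = π} (Admissible.proper okπ)
      π₁≈ρ : AgreeExcept v π₁ ρ
      π₁≈ρ u u≢v = trans (update-agreeExcept π v j u u≢v) (π≈ρ u u≢v)
      π₂≈ρ₂ : AgreeExcept v π₂ ρ₂
      π₂≈ρ₂ u u≢v with u ≟ᶠ w
      ... | yes refl = lookup∘update w π₁ k
      ... | no u≢w = trans (update-agreeExcept π₁ w k u u≢w) (trans (π₁≈ρ u u≢v) (ρ≈ρ₂ u u≢w))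
      okπ₁ : Admissible P R I π₁
      okπ₁ = admissible-recolour {ρ = ρ} {π = π} nontrivial v∈R okρ π₁≈ρ (subst (_∈ P) (sym π₁v≡j) j∈P)
               (λ j∈ → j∉ (thereₗ (subst (_∈ₗ forbidden π v R) π₁v≡j j∈)))
               (λ u u≢v → inj₁ (update-agreeExcept π v j u u≢v))
      okπ₂ : Admissible P R I π₂
      okπ₂ = admissible-recolour {ρ = ρ₂} {π = π} nontrivial v∈R okρ₂ π₂≈ρ₂ (subst (_∈ P) (sym π₂v≡j) j∈P)
               (λ j∈ → j∉ (thereₗ (subst (_∈ₗ forbidden π v R) π₂v≡j j∈)))
               unchanged
        where
        unchanged : ∀ u → u ≢ v → lookup π₂ u ≡ lookup π u ⊎ lookup π₂ u ≢ lookup π₂ v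
        unchanged u u≢v with u ≟ᶠ w
        ... | yes refl =
          inj₂ λ k≡π₂v → j∉ (hereₗ (trans (sym π₂v≡j) (trans (sym k≡π₂v) (lookup∘update w π₁ k))))
        ... | no u≢w = inj₁ (trans (update-agreeExcept π₁ w k u u≢w) (update-agreeExcept π v j u u≢v))

  connect-degenerate : ∀ {R I P σ τ} → Acc _<_ ∣ R ∣ → Degenerate R → suc β ≤ ∣ P ∣ →
                       Admissible P R I σ → Admissible P R I τ → AgreeOutside R σ τ → Path (Admissible P R I) σ τ
  connect-degenerate {R} {I} {P} {σ} {τ} (acc smaller) degR β<∣P∣ okσ okτ σ≈τ with nonempty? R
  ... | no R≡∅ = subst (Path _ σ) (lookup-ext σ τ λ u → σ≈τ u λ u∈R → R≡∅ (u , u∈R)) ε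
  ... | yes R≢∅ with degR R (λ u∈R → u∈R) R≢∅
  ...   | v , v∈R , δv<β = Lift.lift v∈R δv<β β<∣P∣ path (λ _ _ → refl) τ≈τ′ okσ okτ
    where
    τ′ = τ [ v ]≔ lookup σ v
    τ≈τ′ : AgreeExcept v τ τ′
    τ≈τ′ u u≢v = sym (update-agreeExcept τ v (lookup σ v) u u≢v)
    okσ′ : Admissible P (R - v) (I ∪ ⁅ v ⁆) σ
    okσ′ = admissible-forget {σ = σ} okσ λ _ _ → refl
    okτ′ : Admissible P (R - v) (I ∪ ⁅ v ⁆) τ′
    okτ′ = admissible-forget {σ = τ′} okτ (update-agreeExcept τ v (lookup σ v))
    σ≈τ′ : AgreeOutside (R - v) σ τ′
    σ≈τ′ u u∉R-v with u ≟ᶠ v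
    ... | yes refl = sym (lookup∘update v τ (lookup σ v))
    ... | no u≢v = trans (σ≈τ u λ u∈R → u∉R-v (x∈p∧x≢y⇒x∈p-y u∈R u≢v)) (τ≈τ′ u u≢v)
    path = connect-degenerate (smaller (x∈p⇒∣p-x∣<∣p∣ v∈R)) (Degenerate-⊆ x∈p-y⇒x∈p degR) β<∣P∣
                              okσ′ okτ′ σ≈τ′

  ColourableFrom : ℕ → Subset n → Set
  ColourableFrom α R = ¬ (Σ (Vec (Subset n) α) λ Vs → MaxIndSeqFrom H R Vs × HasCore H β (leftover H R Vs))

  colourableFrom-suc : ∀ {α R W} → ColourableFrom (suc α) R → MaxIndependentIn H R W → ColourableFrom α (R ─ W)
  colourableFrom-suc colR maxW (Vs , seq , core) = colR (_ ∷ Vs , (maxW , seq) , core)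

  colourableFrom-zero⇒degenerate : ∀ {R} → ColourableFrom 0 R → Degenerate R
  colourableFrom-zero⇒degenerate colR = coreless⇒degenerate λ core → colR ([] , tt , core)

  extend : ∀ α {R I P σ} → ColourableFrom α R → NontrivialOff I → α + β ≤ ∣ P ∣ →
           ProperOutside R I σ → AvoidsPaletteOutside P R I σ → Extension P R I σ
  extend zero {R} colR = extend-degenerate (<-wellFounded ∣ R ∣) (colourableFrom-zero⇒degenerate colR)
  extend (suc α) {R} {I} {P} {σ} colR nontrivial size properσ avoidsσ = record
    { colouring  = ρ
    ; admissible = mkAdmissible (Admissible.proper okρ) (mkConfined ∈R⇒∈P ∉R⇒∉P)
    ; agrees     = λ u u∉R → trans (ρ≈σ₁ u (λ u∈R─W → u∉R (p─q⊆p R W u∈R─W))) (σ₁≈σ u u∉R)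
    }
    where
    c : Fin q
    c = proj₁ (k<∣p∣⇒nonempty P size)
    c∈P : c ∈ P
    c∈P = proj₂ (k<∣p∣⇒nonempty P size)
    maxIndependent : ∃ λ W → MaxIndependentIn H R W × ⊥ ⊆ W
    maxIndependent = maxIndependent-extension R ⊥ (λ x∈⊥ → ⊥-elim (∉⊥ x∈⊥))
                       (⊥-independent {σ = σ} λ e e∈H e⊆⊥ → properσ e e∈H (⊆⊥⇒avoids e⊆⊥) (⊆⊥⇒avoids e⊆⊥))
    W : Subset n
    W = proj₁ maxIndependent
    maxW : MaxIndependentIn H R W
    maxW = proj₁ (proj₂ maxIndependent)
    W⊆R : W ⊆ R
    W⊆R = proj₁ maxW
    σ₁ : Colouring
    σ₁ = paint W c σ
    σ₁≈σ : AgreeOutside R σ₁ σ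
    σ₁≈σ = paint-agreeOutside {k = c} {σ = σ} W⊆R
    ext : Extension (P - c) (R ─ W) I σ₁
    ext = extend α (colourableFrom-suc colR maxW) nontrivial (k<∣p∣⇒k≤∣p-x∣ P c size)
            (paint-properOutside properσ avoidsσ c∈P (proj₁ (proj₂ maxW))) (paint-avoidsPaletteOutside avoidsσ)
    ρ : Colouring
    ρ = Extension.colouring ext
    okρ : Admissible (P - c) (R ─ W) I ρ
    okρ = Extension.admissible ext
    ρ≈σ₁ : AgreeOutside (R ─ W) ρ σ₁
    ρ≈σ₁ = Extension.agrees ext
    ∈R⇒∈P : ∀ {u} → u ∈ R → lookup ρ u ∈ P
    ∈R⇒∈P {u} u∈R with u ∈? W
    ... | yes u∈W = subst (_∈ P) (sym (trans (ρ≈σ₁ u (λ u∈R─W → x∈p─q⇒x∉q R W u∈R─W u∈W)) (paint-∈ u∈W))) c∈P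
    ... | no u∉W = x∈p-y⇒x∈p (Confined.∈R⇒∈P (Admissible.confined okρ) (x∈p∧x∉q⇒x∈p─q u∈R u∉W))
    ∉R⇒∉P : AvoidsPaletteOutside P R I ρ
    ∉R⇒∉P {u} u∉R u∉I ρu∈P = avoidsσ u∉R u∉I
      (subst (_∈ P) (trans (ρ≈σ₁ u (λ u∈R─W → u∉R (p─q⊆p R W u∈R─W))) (σ₁≈σ u u∉R)) ρu∈P)

  Connects : ℕ → Set
  Connects α = ∀ {R P σ τ} → ColourableFrom α R → suc (α + β) ≤ ∣ P ∣ →
               Admissible P R ⊥ σ → Admissible P R ⊥ τ → AgreeOutside R σ τ → Path (ProperOff ⊥) σ τ

  avoid-colour : ∀ {α R P χ} d → Connects α → ColourableFrom α R → suc (α + β) ≤ ∣ P ∣ → Admissible P R ⊥ χ →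
                 Σ (Extension (P - d) R ⊥ χ) λ ext → Path (ProperOff ⊥) χ (Extension.colouring ext)
  avoid-colour {α} {R} {P} {χ} d connectα colR size okχ@(mkAdmissible properχ confχ) =
    ext , connectα colR size okχ (mkAdmissible (Admissible.proper okρ) (mkConfined ∈R ∉R)) (λ u u∉R → sym (ρ≈χ u u∉R))
    where
    ext : Extension (P - d) R ⊥ χ
    ext = extend α colR (properOff⇒nontrivialOff {σ = χ} properχ) (k<∣p∣⇒k≤∣p-x∣ P d size)
            (λ e e∈H avoids _ → properχ e e∈H avoids)
            (λ u∉R u∉⊥ χu∈P-d → Confined.∉R⇒∉P confχ u∉R u∉⊥ (x∈p-y⇒x∈p χu∈P-d))
    okρ = Extension.admissible ext
    ρ≈χ = Extension.agrees ext
    ∈R : ∀ {u} → u ∈ R → lookup (Extension.colouring ext) u ∈ P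
    ∈R u∈R = x∈p-y⇒x∈p (Confined.∈R⇒∈P (Admissible.confined okρ) u∈R)
    ∉R : AvoidsPaletteOutside P R ⊥ (Extension.colouring ext)
    ∉R {u} u∉R u∉⊥ ρu∈P = Confined.∉R⇒∉P confχ u∉R u∉⊥ (subst (_∈ P) (ρ≈χ u u∉R) ρu∈P)

  record Normalised (P : Palette) (R V : Subset n) (c : Fin q) (χ : Colouring) : Set where
    field
      colouring  : Colouring
      path       : Path (ProperOff ⊥) χ colouring
      admissible : Admissible (P - c) (R ─ V) ⊥ colouring
      V-painted  : ∀ {u} → u ∈ V → lookup colouring u ≡ c
      agrees     : AgreeOutside R colouring χ

  gather-colour : ∀ {P R c χ} → c ∈ P → Admissible P R ⊥ χ →
                  ∃ λ W → MaxIndependentIn H R W × Path (ProperOff ⊥) χ (paint W c χ) ×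
                          Admissible (P - c) (R ─ W) ⊥ (paint W c χ)
  gather-colour {P} {R} {c} {χ} c∈P okχ@(mkAdmissible properχ confχ)
    with maxIndependent-extension R (colourClassIn R c χ) (λ u∈C → proj₁ (∈-colourClassIn⁻ u∈C))
                                  (colourClassIn-independent properχ)
  ... | W , maxW@(W⊆R , indW , _) , C⊆W =
    W , maxW , paint-path indW (colourClass⊆ confχ c∈P c⊆W) properχ , paint-admissible okχ indW c∈P c⊆W
    where
    c⊆W : ∀ {u} → u ∈ R → lookup χ u ≡ c → u ∈ W
    c⊆W u∈R χu≡c = C⊆W (∈-colourClassIn⁺ u∈R χu≡c)

  -- ρ uses colour c only on W; move W to the colour d, unused by ρ inside R,
  -- and then paint V with the colour c, which is now unused altogether.
  exchange-colour : ∀ {P R W V c d ρ} → c ∈ P → d ∈ P - c → W ⊆ R → Independent H W → V ⊆ R → Independent H V →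
                    Admissible (P - c - d) (R ─ W) ⊥ ρ → (∀ {u} → u ∉ R → lookup ρ u ∉ P) → Normalised P R V c ρ
  exchange-colour {P} {R} {W} {V} {c} {d} {ρ} c∈P d∈P-c W⊆R indW V⊆R indV okρ ρ∉P = record
    { colouring  = σ₂
    ; path       = paint-path indW d⊆W (Admissible.proper okρ) ◅◅
                   paint-path indV (λ u σ₁u≡c → contradiction σ₁u≡c (σ₁≢c u)) (Admissible.proper okσ₁)
    ; admissible = paint-fresh-admissible okσ₁ indV (λ c∈P-c → x∈p-y⇒x≢y c∈P-c refl) σ₁≢c
    ; V-painted  = paint-∈
    ; agrees     = λ u u∉R → trans (paint-agreeOutside {k = c} {σ = σ₁} V⊆R u u∉R) (σ₁≈ρ u u∉R)
    }
    where
    ρ≢d : ∀ u → u ∉ R → lookup ρ u ≢ d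
    ρ≢d u u∉R ρu≡d = ρ∉P u∉R (subst (_∈ P) (sym ρu≡d) (x∈p-y⇒x∈p d∈P-c))
    d⊆W : ∀ u → lookup ρ u ≡ d → u ∈ W
    d⊆W u ρu≡d with u ∈? W | u ∈? R
    ... | yes u∈W | _ = u∈W
    ... | no u∉W | yes u∈R = contradiction ρu≡d
                               (x∈p-y⇒x≢y (Confined.∈R⇒∈P (Admissible.confined okρ) (x∈p∧x∉q⇒x∈p─q u∈R u∉W)))
    ... | no _ | no u∉R = contradiction ρu≡d (ρ≢d u u∉R)
    σ₁ = paint W d ρ
    okσ₁ : Admissible (P - c) R ⊥ σ₁
    okσ₁ = paint-admissible⁻ okρ W⊆R indW d∈P-c ρ≢d
    σ₁≈ρ : AgreeOutside R σ₁ ρ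
    σ₁≈ρ = paint-agreeOutside {k = d} {σ = ρ} W⊆R
    σ₂ = paint V c σ₁
    σ₁≢c : ∀ u → lookup σ₁ u ≢ c
    σ₁≢c u with u ∈? R
    ... | yes u∈R = x∈p-y⇒x≢y (Confined.∈R⇒∈P (Admissible.confined okσ₁) u∈R)
    ... | no u∉R = λ σ₁u≡c → ρ∉P u∉R (subst (_∈ P) (trans (sym σ₁u≡c) (σ₁≈ρ u u∉R)) c∈P)

  normalise : ∀ {α R P V c d χ} → Connects α → ColourableFrom (suc α) R → suc (suc α + β) ≤ ∣ P ∣ →
              c ∈ P → d ∈ P - c → MaxIndependentIn H R V → Admissible P R ⊥ χ → Normalised P R V c χ
  normalise {α} {R} {P} {V} {c} {d} {χ} connectα colR size c∈P d∈P-c (V⊆R , indV , _) okχ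
    with gather-colour c∈P okχ
  ... | W , maxW@(W⊆R , indW , _) , gather , okσ
    with avoid-colour d connectα (colourableFrom-suc colR maxW) (k<∣p∣⇒k≤∣p-x∣ P c size) okσ
  ...   | ext , avoid = record
    { colouring  = Normalised.colouring exchange
    ; path       = gather ◅◅ avoid ◅◅ Normalised.path exchange
    ; admissible = Normalised.admissible exchange
    ; V-painted  = Normalised.V-painted exchange
    ; agrees     = λ u u∉R → trans (Normalised.agrees exchange u u∉R) (ρ≈χ u u∉R)
    }
    where
    ρ≈χ : AgreeOutside R (Extension.colouring ext) χ
    ρ≈χ u u∉R = trans (Extension.agrees ext u (λ u∈R─W → u∉R (p─q⊆p R W u∈R─W)))
                      (paint-agreeOutside {k = c} {σ = χ} W⊆R u u∉R)
    exchange = exchange-colour c∈P d∈P-c W⊆R indW V⊆R indV (Extension.admissible ext)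
                 λ {u} u∉R ρu∈P → Confined.∉R⇒∉P (Admissible.confined okχ) u∉R ∉⊥ (subst (_∈ P) (ρ≈χ u u∉R) ρu∈P)

  connect : ∀ α → Connects α
  connect zero {R} colR size okσ okτ σ≈τ =
    path-weaken Admissible.proper
      (connect-degenerate (<-wellFounded ∣ R ∣) (colourableFrom-zero⇒degenerate colR) size okσ okτ σ≈τ)
  connect (suc α) {R} {P} {σ} {τ} colR size okσ okτ σ≈τ =
    Normalised.path σ* ◅◅
    connect α (colourableFrom-suc colR maxV) size′ (Normalised.admissible σ*) (Normalised.admissible τ*) σ*≈τ* ◅◅
    path-reverse (Normalised.path τ*)
    where
    c = proj₁ (k<∣p∣⇒nonempty P size)
    c∈P = proj₂ (k<∣p∣⇒nonempty P size)
    size′ : suc (α + β) ≤ ∣ P - c ∣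
    size′ = k<∣p∣⇒k≤∣p-x∣ P c size
    d = proj₁ (k<∣p∣⇒nonempty (P - c) size′)
    d∈P-c = proj₂ (k<∣p∣⇒nonempty (P - c) size′)
    properσ = Admissible.proper okσ
    extV = maxIndependent-extension R ⊥ (λ x∈⊥ → ⊥-elim (∉⊥ x∈⊥))
             (⊥-independent {σ = σ} λ e e∈H e⊆⊥ → properσ e e∈H (⊆⊥⇒avoids e⊆⊥))
    V = proj₁ extV
    maxV = proj₁ (proj₂ extV)
    σ* = normalise (connect α) colR size c∈P d∈P-c maxV okσ
    τ* = normalise (connect α) colR size c∈P d∈P-c maxV okτ
    σ*≈τ* : AgreeOutside (R ─ V) (Normalised.colouring σ*) (Normalised.colouring τ*)
    σ*≈τ* u u∉R─V with u ∈? V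
    ... | yes u∈V = trans (Normalised.V-painted σ* u∈V) (sym (Normalised.V-painted τ* u∈V))
    ... | no u∉V = trans (Normalised.agrees σ* u u∉R) (trans (σ≈τ u u∉R) (sym (Normalised.agrees τ* u u∉R)))
      where
      u∉R : u ∉ R
      u∉R u∈R = u∉R─V (x∈p∧x∉q⇒x∈p─q u∈R u∉V)

theorem2 : ∀ {n : ℕ} (H : Hypergraph n) (α β q : ℕ) →
    Colorable H α β → q ≥ suc (α + β) → GammaConnected H q
theorem2 H α β q colH q≥ σ τ properσ properτ =
  path⇒walk (proper⇒properOff {σ = σ} properσ) (connect α colH size (admissible properσ) (admissible properτ) agree)
  where
  open Recolouring H q
  open Reconfiguration H q β
  size : suc (α + β) ≤ ∣ ⊤ {q} ∣
  size = subst (suc (α + β) ≤_) (sym (∣⊤∣≡n q)) q≥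
  admissible : ∀ {χ} → Proper H χ → Admissible ⊤ ⊤ ⊥ χ
  admissible {χ} properχ =
    mkAdmissible (proper⇒properOff {σ = χ} properχ) (mkConfined (λ _ → ∈⊤) (λ u∉⊤ → ⊥-elim (u∉⊤ ∈⊤)))
  agree : AgreeOutside ⊤ σ τ
  agree u u∉⊤ = ⊥-elim (u∉⊤ ∈⊤)
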